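{- For every positive integer $n$, we have \[r_<(NM^<_n,K^<_3)\leq \left(3+\sqrt 5\right)n +1.\]
   Context: An ordered graph on $N$ vertices is a graph with vertex set $[N]=\{1,\dots,N\}$ ordered by the usual order of integers. An ordered graph $G^<$ on $[n]$ is an ordered subgraph of an ordered graph $H^<$ on $[N]$ if there is a map $\phi:[n]\to[N]$ with $\phi(i)<\phi(j)$ whenever $i<j$ such that $\{\phi(i),\phi(j)\}$ is an edge of $H^<$ whenever $\{i,j\}$ is an edge of $G^<$. $K^<_N$ is the complete ordered graph on $[N]$. For ordered graphs $G^<,H^<$, the ordered Ramsey number $r_<(G^<,H^<)$ is the least $N$ such that every red-blue coloring of the edges of $K^<_N$ contains a red copy of $G^<$ or a blue copy of $H^<$ as an ordered subgraph. For $n\in\mathbb{N}$, the nested matching $NM^<_n$ is the ordered graph on $[2n]$ with edges $\{i,2n-i+1\}$ for $i\in[n]$. -}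

module Defs where

open import Data.Nat using (ℕ; suc; _+_; _*_; _∸_; _≤_; _<_)
open import Data.Fin using (Fin; toℕ)
open import Data.Product using (Σ; _×_; ∃-syntax)
open import Relation.Binary.PropositionalEquality using (_≡_; _≢_)

-- An ordered graph on n vertices: an edge relation on Fin n.
-- (Only pairs i < j are ever consulted; edges are unordered.)
OrderedGraph : ℕ → Set₁
OrderedGraph n = Fin n → Fin n → Set

data Colour : Set where
  red blue : Colour

-- A red-blue colouring of the edges of K^<_N: the colour of the edge {i,j}
-- with i < j is c i j (values with i ≥ j are irrelevant).
Colouring : ℕ → Set
Colouring N = Fin N → Fin N → Colour

StrictlyIncreasing : {n N : ℕ} → (Fin n → Fin N) → Set
StrictlyIncreasing {n} φ = (i j : Fin n) → toℕ i < toℕ j → toℕ (φ i) < toℕ (φ j)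

MonoCopy : {n N : ℕ} → Colour → OrderedGraph n → Colouring N → Set
MonoCopy {n} {N} k G c =
  Σ (Fin n → Fin N) λ φ →
    StrictlyIncreasing φ ×
    ((i j : Fin n) → toℕ i < toℕ j → G i j → c (φ i) (φ j) ≡ k)

Arrows : {n m : ℕ} → ℕ → OrderedGraph n → OrderedGraph m → Set
Arrows N G H = (c : Colouring N) → MonoCopy red G c Data.Sum.⊎ MonoCopy blue H c
  where import Data.Sum

Complete : (m : ℕ) → OrderedGraph m
Complete m i j = i ≢ j

-- Nested matching NM^<_n on 2n vertices: in 1-based indexing edges are
-- {i, 2n-i+1}; in 0-based indexing, {i, j} with i + j = 2n - 1,
-- i.e. i + j + 1 = 2n.
NestedMatching : (n : ℕ) → OrderedGraph (2 * n)
NestedMatching n i j = toℕ i + toℕ j + 1 ≡ 2 * n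

-- "N ≤ (3 + √5) n + 1" for naturals N, n, expressed without reals:
-- with d = N ∸ (3n+1) (truncated), the inequality holds iff d² ≤ 5n².
LeThreePlusSqrt5TimesPlusOne : ℕ → ℕ → Set
LeThreePlusSqrt5TimesPlusOne N n =
  (N ∸ (3 * n + 1)) * (N ∸ (3 * n + 1)) ≤ 5 * (n * n)

module Submission where

-- Suppose a colouring of K_N has no red NM_n and no blue triangle, and let ν < n be the size
-- of a largest red nested matching. The blue neighbourhood of any vertex spans a red clique,
-- and r ordered vertices of a red clique carry a red nested matching of size ⌊r/2⌋, so every
-- blue degree is at most 2ν + 1. Give a red edge uw the level of the largest red nested
-- matching strictly between u and w: levels are below ν, and of two red edges with the same
-- endpoint sum u + w one is nested in the other and so has a smaller level. A red edge of
-- level j has 2j + 1 ≤ u + w ≤ 2N - 2j - 3, so there are at most ∑_{j<n-1} (2N - 4j - 3)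
-- red edges. Counting degrees then gives N² ≤ 2·#red + 2nN, a quadratic inequality in N
-- that fails for N = ⌊(3 + √5) n⌋ + 1.

open import Algebra.Properties.CommutativeSemigroup using (interchange)
open import Data.Empty using (⊥; ⊥-elim)
open import Data.Fin using (Fin; toℕ) renaming (zero to fzero; suc to fsuc)
open import Data.Fin.Properties using (toℕ<n; toℕ-fromℕ<; any?)
open import Data.Nat
open import Data.Nat.DivMod using (_mod_; m<n⇒m%n≡m)
open import Data.Nat.Properties
open import Data.Nat.Tactic.RingSolver using (solve-∀)
open import Data.Product using (_×_; _,_; proj₁; proj₂; ∃-syntax)
open import Data.Sum using (_⊎_; inj₁; inj₂; [_,_]′)
open import Function using (_∘_)
open import Relation.Binary.Definitions using (tri<; tri≈; tri>)
open import Relation.Binary.PropositionalEquality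
open import Relation.Nullary using (¬_; Dec; yes; no)
open import Relation.Nullary.Decidable using (_×-dec_; _⊎-dec_)
open import Relation.Unary using (Pred; Decidable)

open import Defs

<-+-compensate : ∀ {a b x y} → a < b → a + x ≡ b + y → y < x
<-+-compensate {a} {b} {x} {y} a<b eq = +-cancelˡ-< b y x (begin-strict
  b + y ≡⟨ eq ⟨
  a + x <⟨ +-monoˡ-< x a<b ⟩
  b + x ∎)
  where open ≤-Reasoning

≤-⊔-cases : ∀ {k} x y → k ≤ x ⊔ y → k ≤ x ⊎ k ≤ y
≤-⊔-cases x y k≤x⊔y with ⊔-sel x y
... | inj₁ eq = inj₁ (subst (_ ≤_) eq k≤x⊔y)
... | inj₂ eq = inj₂ (subst (_ ≤_) eq k≤x⊔y)

∑< : ℕ → (ℕ → ℕ) → ℕ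
∑< zero    f = 0
∑< (suc k) f = ∑< k f + f k

syntax ∑< k (λ i → e) = ∑[ i < k ] e

∑-cong : ∀ k {f g : ℕ → ℕ} → (∀ i → i < k → f i ≡ g i) → ∑< k f ≡ ∑< k g
∑-cong zero    eq = refl
∑-cong (suc k) eq = cong₂ _+_ (∑-cong k (λ i i<k → eq i (m<n⇒m<1+n i<k))) (eq k ≤-refl)

∑-mono-≤ : ∀ k {f g : ℕ → ℕ} → (∀ i → i < k → f i ≤ g i) → ∑< k f ≤ ∑< k g
∑-mono-≤ zero    le = z≤n
∑-mono-≤ (suc k) le = +-mono-≤ (∑-mono-≤ k (λ i i<k → le i (m<n⇒m<1+n i<k))) (le k ≤-refl)

∑-const : ∀ k c → ∑[ _ < k ] c ≡ k * c
∑-const zero    c = refl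
∑-const (suc k) c = trans (cong (_+ c) (∑-const k c)) (+-comm (k * c) c)

∑-zero : ∀ k {f : ℕ → ℕ} → (∀ i → i < k → f i ≡ 0) → ∑< k f ≡ 0
∑-zero k {f} eq = trans (∑-cong k eq) (trans (∑-const k 0) (*-zeroʳ k))

∑-distrib-+ : ∀ k (f g : ℕ → ℕ) → ∑[ i < k ] (f i + g i) ≡ ∑< k f + ∑< k g
∑-distrib-+ zero    f g = refl
∑-distrib-+ (suc k) f g = trans (cong (_+ (f k + g k)) (∑-distrib-+ k f g))
                                (interchange +-commutativeSemigroup (∑< k f) (∑< k g) (f k) (g k))

∑-comm : ∀ k l (f : ℕ → ℕ → ℕ) → ∑[ i < k ] ∑[ j < l ] f i j ≡ ∑[ j < l ] ∑[ i < k ] f i j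
∑-comm zero    l f = sym (∑-zero l (λ _ _ → refl))
∑-comm (suc k) l f = trans (cong (_+ ∑[ j < l ] f k j) (∑-comm k l f))
                           (sym (∑-distrib-+ l (λ j → ∑[ i < k ] f i j) (f k)))

∑-head : ∀ k (f : ℕ → ℕ) → ∑< (suc k) f ≡ f 0 + ∑[ i < k ] f (suc i)
∑-head zero    f = +-comm 0 (f 0)
∑-head (suc k) f = trans (cong (_+ f (suc k)) (∑-head k f)) (+-assoc (f 0) _ (f (suc k)))

∑-≤1 : ∀ k {f : ℕ → ℕ} → (∀ i → i < k → f i ≤ 1) →
       (∀ i j → i < k → j < k → 0 < f i → 0 < f j → i ≡ j) → ∑< k f ≤ 1
∑-≤1 zero    bound unique = z≤n
∑-≤1 (suc k) {f} bound unique with f k in fk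
... | zero  = ≤-trans (≤-reflexive (+-identityʳ _))
                (∑-≤1 k (λ i i<k → bound i (m<n⇒m<1+n i<k))
                        (λ i j i<k j<k → unique i j (m<n⇒m<1+n i<k) (m<n⇒m<1+n j<k)))
... | suc m = subst (λ s → s + suc m ≤ 1) (sym (∑-zero k earlierZero)) (subst (_≤ 1) fk (bound k ≤-refl))
  where
  earlierZero : ∀ i → i < k → f i ≡ 0
  earlierZero i i<k with f i in fi
  ... | zero  = refl
  ... | suc _ = ⊥-elim (<-irrefl (unique i k (m<n⇒m<1+n i<k) ≤-refl (subst (0 <_) (sym fi) z<s)
                                                                       (subst (0 <_) (sym fk) z<s)) i<k)

∑-pos⇒∃ : ∀ k {f : ℕ → ℕ} → 0 < ∑< k f → ∃[ i ] i < k × 0 < f i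
∑-pos⇒∃ zero    ()
∑-pos⇒∃ (suc k) {f} pos with f k in fk
... | suc _ = k , ≤-refl , subst (0 <_) (sym fk) z<s
... | zero  with ∑-pos⇒∃ k (subst (0 <_) (+-identityʳ _) pos)
...   | i , i<k , fi = i , m<n⇒m<1+n i<k , fi

𝟙 : ∀ {ℓ} {A : Set ℓ} → Dec A → ℕ
𝟙 (yes _) = 1
𝟙 (no  _) = 0

𝟙≤1 : ∀ {ℓ} {A : Set ℓ} (a? : Dec A) → 𝟙 a? ≤ 1
𝟙≤1 (yes _) = ≤-refl
𝟙≤1 (no  _) = z≤n

𝟙-pos⇒ : ∀ {ℓ} {A : Set ℓ} (a? : Dec A) → 0 < 𝟙 a? → A
𝟙-pos⇒ (yes a) _ = a

𝟙-yes : ∀ {ℓ} {A : Set ℓ} (a? : Dec A) → A → 𝟙 a? ≡ 1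
𝟙-yes (yes _) _ = refl
𝟙-yes (no ¬a) a = ⊥-elim (¬a a)

𝟙-no : ∀ {ℓ} {A : Set ℓ} (a? : Dec A) → ¬ A → 𝟙 a? ≡ 0
𝟙-no (yes a) ¬a = ⊥-elim (¬a a)
𝟙-no (no _)  _  = refl

𝟙-⊎-≤ : ∀ {ℓ ℓ′} {A : Set ℓ} {B : Set ℓ′} (a? : Dec A) (b? : Dec B) → 𝟙 (a? ⊎-dec b?) ≤ 𝟙 a? + 𝟙 b?
𝟙-⊎-≤ (yes _) _       = s≤s z≤n
𝟙-⊎-≤ (no _)  (yes _) = ≤-refl
𝟙-⊎-≤ (no _)  (no _)  = z≤n

≤1⇒≤𝟙 : ∀ {ℓ} {A : Set ℓ} {m} (a? : Dec A) → m ≤ 1 → (0 < m → A) → m ≤ 𝟙 a?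
≤1⇒≤𝟙 (yes _) m≤1 _   = m≤1
≤1⇒≤𝟙 {m = zero}  (no _) _ _   = z≤n
≤1⇒≤𝟙 {m = suc _} (no ¬a) _ ⇒a = ⊥-elim (¬a (⇒a z<s))

module _ {ℓ} {P : Pred ℕ ℓ} (P? : Decidable P) where

  ∑-𝟙-≤1 : ∀ k → (∀ i j → i < k → j < k → P i → P j → i ≡ j) → ∑[ i < k ] 𝟙 (P? i) ≤ 1
  ∑-𝟙-≤1 k unique = ∑-≤1 k (λ i _ → 𝟙≤1 (P? i))
    (λ i j i<k j<k pi pj → unique i j i<k j<k (𝟙-pos⇒ (P? i) pi) (𝟙-pos⇒ (P? j) pj))

  ∑-𝟙-pos⇒∃ : ∀ k → 0 < ∑[ i < k ] 𝟙 (P? i) → ∃[ i ] i < k × P i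
  ∑-𝟙-pos⇒∃ k pos with ∑-pos⇒∃ k pos
  ... | i , i<k , posᵢ = i , i<k , 𝟙-pos⇒ (P? i) posᵢ

  ∑-𝟙-witness : ∀ k {x} → x < k → P x → 1 ≤ ∑[ i < k ] 𝟙 (P? i)
  ∑-𝟙-witness (suc k) {x} x<1+k px with m≤n⇒m<n∨m≡n (s≤s⁻¹ x<1+k)
  ... | inj₁ x<k  = ≤-trans (∑-𝟙-witness k x<k px) (m≤m+n _ _)
  ... | inj₂ refl = ≤-trans (≤-reflexive (sym (𝟙-yes (P? x) px))) (m≤n+m _ _)

∑-𝟙-interval : ∀ lo hi T → ∑[ s < T ] 𝟙 (lo ≤? s ×-dec s <? hi) ≤ hi ∸ lo
∑-𝟙-interval lo hi T = ≤-trans (capped T) (∸-monoˡ-≤ lo (m⊓n≤n T hi))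
  where
  capped : ∀ T → ∑[ s < T ] 𝟙 (lo ≤? s ×-dec s <? hi) ≤ (T ⊓ hi) ∸ lo
  capped zero    = z≤n
  capped (suc T) with lo ≤? T ×-dec T <? hi
  ... | yes (lo≤T , T<hi) = begin
    ∑[ s < T ] 𝟙 (lo ≤? s ×-dec s <? hi) + 1 ≤⟨ +-monoˡ-≤ 1 (capped T) ⟩
    (T ⊓ hi) ∸ lo + 1                        ≡⟨ cong (λ m → m ∸ lo + 1) (m≤n⇒m⊓n≡m (<⇒≤ T<hi)) ⟩
    T ∸ lo + 1                               ≡⟨ +-comm (T ∸ lo) 1 ⟩
    suc (T ∸ lo)                             ≡⟨ +-∸-assoc 1 lo≤T ⟨
    suc T ∸ lo                               ≡⟨ cong (_∸ lo) (m≤n⇒m⊓n≡m T<hi) ⟨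
    (suc T ⊓ hi) ∸ lo                        ∎
    where open ≤-Reasoning
  ... | no _ = ≤-trans (≤-reflexive (+-identityʳ _))
                       (≤-trans (capped T) (∸-monoˡ-≤ lo (⊓-monoˡ-≤ hi (n≤1+n T))))

module _ {ℓ} {Q : ℕ → ℕ → Set ℓ} (Q? : ∀ u v → Dec (Q u v)) (m n : ℕ) where

  ∑∑-𝟙-pos⇒∃ : 0 < ∑[ u < m ] ∑[ v < n ] 𝟙 (Q? u v) → ∃[ u ] ∃[ v ] u < m × v < n × Q u v
  ∑∑-𝟙-pos⇒∃ pos with ∑-pos⇒∃ m pos
  ... | u , u<m , posᵤ with ∑-𝟙-pos⇒∃ (Q? u) n posᵤ
  ...   | v , v<n , q = u , v , u<m , v<n , q

  ∑∑-𝟙-≤1 : (∀ u v u′ v′ → Q u v → Q u′ v′ → u ≡ u′ × v ≡ v′) → ∑[ u < m ] ∑[ v < n ] 𝟙 (Q? u v) ≤ 1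
  ∑∑-𝟙-≤1 unique = ∑-≤1 m (λ u _ → ∑-𝟙-≤1 (Q? u) n λ v v′ _ _ q q′ → proj₂ (unique u v u v′ q q′))
    λ u u′ _ _ pos pos′ → let v  , _ , q  = ∑-𝟙-pos⇒∃ (Q? u)  n pos
                              v′ , _ , q′ = ∑-𝟙-pos⇒∃ (Q? u′) n pos′
                          in proj₁ (unique u v u′ v′ q q′)

  ∑∑-𝟙-fibres : ∀ K (g : ℕ → ℕ → ℕ) → (∀ u v → u < m → v < n → Q u v → g u v < K) →
    ∑[ u < m ] ∑[ v < n ] 𝟙 (Q? u v) ≤ ∑[ j < K ] ∑[ u < m ] ∑[ v < n ] 𝟙 (Q? u v ×-dec g u v ≟ j)
  ∑∑-𝟙-fibres K g g<K = begin
    ∑[ u < m ] ∑[ v < n ] 𝟙 (Q? u v)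
      ≤⟨ ∑-mono-≤ m (λ u u<m → ∑-mono-≤ n (λ v v<n → inFibre u v u<m v<n)) ⟩
    ∑[ u < m ] ∑[ v < n ] ∑[ j < K ] 𝟙 (Q? u v ×-dec g u v ≟ j)
      ≡⟨ ∑-cong m (λ u _ → ∑-comm n K (λ v j → 𝟙 (Q? u v ×-dec g u v ≟ j))) ⟩
    ∑[ u < m ] ∑[ j < K ] ∑[ v < n ] 𝟙 (Q? u v ×-dec g u v ≟ j)
      ≡⟨ ∑-comm m K (λ u j → ∑[ v < n ] 𝟙 (Q? u v ×-dec g u v ≟ j)) ⟩
    ∑[ j < K ] ∑[ u < m ] ∑[ v < n ] 𝟙 (Q? u v ×-dec g u v ≟ j) ∎
    where
    open ≤-Reasoning
    inFibre : ∀ u v → u < m → v < n → 𝟙 (Q? u v) ≤ ∑[ j < K ] 𝟙 (Q? u v ×-dec g u v ≟ j)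
    inFibre u v u<m v<n with Q? u v
    ... | yes q = ∑-𝟙-witness (λ j → yes q ×-dec g u v ≟ j) K (g<K u v u<m v<n q) (q , refl)
    ... | no _  = z≤n

module _ {ℓ} {F : ℕ → ℕ → Set ℓ} (F? : ∀ u v → Dec (F u v)) (N lo hi : ℕ) where

  ∑∑-𝟙-distinct-sums :
    (∀ u v → u < N → v < N → F u v → lo ≤ u + v × u + v < hi) →
    (∀ u v u′ v′ → F u v → F u′ v′ → u + v ≡ u′ + v′ → u ≡ u′) →
    ∑[ u < N ] ∑[ v < N ] 𝟙 (F? u v) ≤ hi ∸ lo
  ∑∑-𝟙-distinct-sums inRange unique = begin
    ∑[ u < N ] ∑[ v < N ] 𝟙 (F? u v)
      ≤⟨ ∑∑-𝟙-fibres F? N N (N + N) _+_ (λ u v u<N v<N _ → +-mono-< u<N v<N) ⟩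
    ∑[ s < N + N ] ∑[ u < N ] ∑[ v < N ] 𝟙 (F? u v ×-dec u + v ≟ s)
      ≤⟨ ∑-mono-≤ (N + N) (λ s _ → fibre≤1 s) ⟩
    ∑[ s < N + N ] 𝟙 (lo ≤? s ×-dec s <? hi)
      ≤⟨ ∑-𝟙-interval lo hi (N + N) ⟩
    hi ∸ lo ∎
    where
    open ≤-Reasoning
    fibre≤1 : ∀ s → ∑[ u < N ] ∑[ v < N ] 𝟙 (F? u v ×-dec u + v ≟ s) ≤ 𝟙 (lo ≤? s ×-dec s <? hi)
    fibre≤1 s = ≤1⇒≤𝟙 (lo ≤? s ×-dec s <? hi)
      (∑∑-𝟙-≤1 Q? N N λ u v u′ v′ (f , eq) (f′ , eq′) →
         let sums = trans eq (sym eq′)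
             u≡u′ = unique u v u′ v′ f f′ sums
         in u≡u′ , +-cancelˡ-≡ u v v′ (trans sums (cong (_+ v′) (sym u≡u′))))
      λ pos → let u , v , u<N , v<N , f , eq = ∑∑-𝟙-pos⇒∃ Q? N N pos
              in subst (λ t → lo ≤ t × t < hi) eq (inRange u v u<N v<N f)
      where
      Q? : ∀ u v → Dec (F u v × u + v ≡ s)
      Q? u v = F? u v ×-dec u + v ≟ s

_≟ᶜ_ : (x y : Colour) → Dec (x ≡ y)
red  ≟ᶜ red  = yes refl
red  ≟ᶜ blue = no λ ()
blue ≟ᶜ red  = no λ ()
blue ≟ᶜ blue = yes refl

module NestedMatchings (col : ℕ → ℕ → Colour) where

  arc : Colour → ℕ → ℕ
  arc red  k = suc k
  arc blue k = 0

  arc-pos : ∀ x k {m} → suc m ≤ arc x k → x ≡ red × m ≤ k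
  arc-pos red k (s≤s m≤k) = refl , m≤k

  -- ν a len is the size of a largest red nested matching inside [a, a + len): drop the
  -- first vertex, drop the last one, or match the two and recurse strictly inside.
  ν : ℕ → ℕ → ℕ
  ν a zero          = 0
  ν a (suc zero)    = 0
  ν a (suc (suc l)) = ν (suc a) (suc l) ⊔ ν a (suc l) ⊔ arc (col a (a + suc l)) (ν (suc a) l)

  ν-dropˡ : ∀ a len → ν (suc a) len ≤ ν a (suc len)
  ν-dropˡ a zero    = z≤n
  ν-dropˡ a (suc l) = m≤n⇒m≤n⊔o _ (m≤m⊔n (ν (suc a) (suc l)) (ν a (suc l)))

  ν-dropʳ : ∀ a len → ν a len ≤ ν a (suc len)
  ν-dropʳ a zero    = z≤n
  ν-dropʳ a (suc l) = m≤n⇒m≤n⊔o _ (m≤n⊔m (ν (suc a) (suc l)) (ν a (suc l)))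

  ν-arc : ∀ a l → col a (a + suc l) ≡ red → suc (ν (suc a) l) ≤ ν a (suc (suc l))
  ν-arc a l red-arc rewrite red-arc = m≤n⊔m (ν (suc a) (suc l) ⊔ ν a (suc l)) (suc (ν (suc a) l))

  ν-half : ∀ a len → ν a len + ν a len ≤ len
  ν-half a zero          = z≤n
  ν-half a (suc zero)    = z≤n
  ν-half a (suc (suc l)) =
    ⊔-double (νˡ ⊔ νʳ) νᵃ (⊔-double νˡ νʳ (≤-trans (ν-half (suc a) (suc l)) (n≤1+n _))
                                          (≤-trans (ν-half a (suc l)) (n≤1+n _)))
                         (arc-double (col a (a + suc l)))
    where
    νˡ = ν (suc a) (suc l)
    νʳ = ν a (suc l)
    νᵃ = arc (col a (a + suc l)) (ν (suc a) l)
    ⊔-double : ∀ x y → x + x ≤ suc (suc l) → y + y ≤ suc (suc l) → (x ⊔ y) + (x ⊔ y) ≤ suc (suc l)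
    ⊔-double x y x+x≤n y+y≤n with ⊔-sel x y
    ... | inj₁ eq rewrite eq = x+x≤n
    ... | inj₂ eq rewrite eq = y+y≤n
    arc-double : ∀ x → arc x (ν (suc a) l) + arc x (ν (suc a) l) ≤ suc (suc l)
    arc-double red  = s≤s (subst (_≤ suc l) (sym (+-suc _ _)) (s≤s (ν-half (suc a) l)))
    arc-double blue = z≤n

  ν-dropsˡ : ∀ a d len → ν (a + d) len ≤ ν a (d + len)
  ν-dropsˡ a zero    len = ≤-reflexive (cong (λ b → ν b len) (+-identityʳ a))
  ν-dropsˡ a (suc d) len = begin
    ν (a + suc d) len   ≡⟨ cong (λ b → ν b len) (+-suc a d) ⟩
    ν (suc (a + d)) len ≤⟨ ν-dropˡ (a + d) len ⟩
    ν (a + d) (suc len) ≤⟨ ν-dropsˡ a d (suc len) ⟩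
    ν a (d + suc len)   ≡⟨ cong (ν a) (+-suc d len) ⟩
    ν a (suc d + len)   ∎
    where open ≤-Reasoning

  ν-dropsʳ : ∀ a len e → ν a len ≤ ν a (len + e)
  ν-dropsʳ a len zero    = ≤-reflexive (cong (ν a) (sym (+-identityʳ len)))
  ν-dropsʳ a len (suc e) = ≤-trans (ν-dropsʳ a len e)
                                   (≤-trans (ν-dropʳ a (len + e)) (≤-reflexive (cong (ν a) (sym (+-suc len e)))))

  ν-mono : ∀ {a b len len′} → a ≤ b → b + len′ ≤ a + len → ν b len′ ≤ ν a len
  ν-mono {a} {b} {len} {len′} a≤b fits with m≤n⇒∃[o]m+o≡n a≤b
  ... | d , refl with m≤n⇒∃[o]m+o≡n fits
  ...   | e , eq = begin
    ν (a + d) len′     ≤⟨ ν-dropsˡ a d len′ ⟩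
    ν a (d + len′)     ≤⟨ ν-dropsʳ a (d + len′) e ⟩
    ν a (d + len′ + e) ≡⟨ cong (ν a) (+-cancelˡ-≡ a _ _ (trans (sym (reassoc a d len′ e)) eq)) ⟩
    ν a len            ∎
    where
    open ≤-Reasoning
    reassoc : ∀ a d l e → a + d + l + e ≡ a + (d + l + e)
    reassoc a d l e = trans (cong (_+ e) (+-assoc a d l)) (+-assoc a (d + l) e)

  record NestedRedMatching (k a len : ℕ) : Set where
    field
      left right : ℕ → ℕ
      inside     : ∀ i → i < k → a ≤ left i × right i < a + len
      left<right : ∀ i j → i < k → j < k → left i < right j
      nested     : ∀ i j → i < j → j < k → left i < left j × right j < right i
      red-arcs   : ∀ i → i < k → col (left i) (right i) ≡ red

  empty : ∀ {a len} → NestedRedMatching 0 a len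
  empty = record { left = λ _ → 0 ; right = λ _ → 0 ; inside = λ _ () ; left<right = λ _ _ () ;
                   nested = λ _ _ _ () ; red-arcs = λ _ () }

  widen : ∀ {k a len b len′} → NestedRedMatching k b len′ → a ≤ b → b + len′ ≤ a + len →
          NestedRedMatching k a len
  widen M a≤b fits = record
    { left = left ; right = right ; left<right = left<right ; nested = nested ; red-arcs = red-arcs
    ; inside = λ i i<k → let b≤l , r< = inside i i<k in ≤-trans a≤b b≤l , <-≤-trans r< fits }
    where open NestedRedMatching M

  enclose : ∀ {k a l} → NestedRedMatching k (suc a) l → col a (a + suc l) ≡ red →
            NestedRedMatching (suc k) a (suc (suc l))
  enclose {k} {a} {l} M red-arc = record
    { left = left′ ; right = right′ ; inside = inside′ ; left<right = left<right′ ;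
      nested = nested′ ; red-arcs = red-arcs′ }
    where
    open NestedRedMatching M
    last = a + suc l
    left′ right′ : ℕ → ℕ
    left′  zero    = a
    left′  (suc i) = left i
    right′ zero    = last
    right′ (suc i) = right i
    a<left : ∀ i → i < k → a < left i
    a<left i i<k = proj₁ (inside i i<k)
    right<last : ∀ i → i < k → right i < last
    right<last i i<k = subst (right i <_) (sym (+-suc a l)) (proj₂ (inside i i<k))
    last<end : last < a + suc (suc l)
    last<end = +-monoʳ-< a ≤-refl
    inside′ : ∀ i → i < suc k → a ≤ left′ i × right′ i < a + suc (suc l)
    inside′ zero    _         = ≤-refl , last<end
    inside′ (suc i) (s≤s i<k) = <⇒≤ (a<left i i<k) , <-trans (right<last i i<k) last<end
    left<right′ : ∀ i j → i < suc k → j < suc k → left′ i < right′ j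
    left<right′ zero    zero    _         _         = m<m+n a z<s
    left<right′ zero    (suc j) _         (s≤s j<k) = <-trans (a<left j j<k) (left<right j j j<k j<k)
    left<right′ (suc i) zero    (s≤s i<k) _         = <-trans (left<right i i i<k i<k) (right<last i i<k)
    left<right′ (suc i) (suc j) (s≤s i<k) (s≤s j<k) = left<right i j i<k j<k
    nested′ : ∀ i j → i < j → j < suc k → left′ i < left′ j × right′ j < right′ i
    nested′ zero    (suc j) _         (s≤s j<k) = a<left j j<k , right<last j j<k
    nested′ (suc i) (suc j) (s≤s i<j) (s≤s j<k) = nested i j i<j j<k
    red-arcs′ : ∀ i → i < suc k → col (left′ i) (right′ i) ≡ red
    red-arcs′ zero    _         = red-arc
    red-arcs′ (suc i) (s≤s i<k) = red-arcs i i<k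

  realise : ∀ len a {k} → k ≤ ν a len → NestedRedMatching k a len
  realise len           a {zero}  _   = empty
  realise (suc (suc l)) a {suc k} k<ν =
    [ [ (λ k<ν′ → widen (realise (suc l) (suc a) k<ν′) (n≤1+n a) (≤-reflexive (sym (+-suc a (suc l)))))
      , (λ k<ν′ → widen (realise (suc l) a k<ν′) ≤-refl (+-monoʳ-≤ a (n≤1+n _))) ]′
        ∘ ≤-⊔-cases (ν (suc a) (suc l)) (ν a (suc l))
    , (λ k<arc → let red-arc , k≤ν = arc-pos (col a (a + suc l)) _ k<arc
                 in enclose (realise l (suc a) k≤ν) red-arc) ]′
      (≤-⊔-cases (ν (suc a) (suc l) ⊔ ν a (suc l)) (arc (col a (a + suc l)) (ν (suc a) l)) k<ν)

  module _ {ℓ} {P : Pred ℕ ℓ} (P? : Decidable P)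
           (clique : ∀ x y → x < y → P x → P y → col x y ≡ red) where

    open ≤-Reasoning

    private
      split-first : ∀ {a} len → ∑[ i < suc len ] 𝟙 (P? (a + i)) ≡ 𝟙 (P? a) + ∑[ i < len ] 𝟙 (P? (suc a + i))
      split-first {a} len = trans (∑-head len (λ i → 𝟙 (P? (a + i))))
        (cong₂ _+_ (cong (λ x → 𝟙 (P? x)) (+-identityʳ a)) (∑-cong len λ i _ → cong (λ x → 𝟙 (P? x)) (+-suc a i)))

      twice+1-mono : ∀ {x y} → x ≤ y → x + x + 1 ≤ y + y + 1
      twice+1-mono x≤y = +-monoˡ-≤ 1 (+-mono-≤ x≤y x≤y)

    clique-≤ : ∀ a len → ∑[ i < len ] 𝟙 (P? (a + i)) ≤ ν a len + ν a len + 1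
    clique-≤ a zero          = z≤n
    clique-≤ a (suc zero)    = 𝟙≤1 (P? (a + 0))
    clique-≤ a (suc (suc l)) =
      by-endpoints (P? a) (P? (a + suc l)) (clique-≤ (suc a) (suc l)) (clique-≤ a (suc l)) (clique-≤ (suc a) l)
      where
      count : ℕ → ℕ → ℕ
      count b len = ∑[ i < len ] 𝟙 (P? (b + i))
      by-endpoints : Dec (P a) → Dec (P (a + suc l)) →
        count (suc a) (suc l) ≤ ν (suc a) (suc l) + ν (suc a) (suc l) + 1 →
        count a (suc l) ≤ ν a (suc l) + ν a (suc l) + 1 →
        count (suc a) l ≤ ν (suc a) l + ν (suc a) l + 1 →
        count a (suc (suc l)) ≤ ν a (suc (suc l)) + ν a (suc (suc l)) + 1
      by-endpoints (no ¬pa) _ ih _ _ = begin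
        count a (suc (suc l))             ≡⟨ split-first (suc l) ⟩
        𝟙 (P? a) + count (suc a) (suc l) ≡⟨ cong (_+ count (suc a) (suc l)) (𝟙-no (P? a) ¬pa) ⟩
        count (suc a) (suc l)             ≤⟨ ih ⟩
        ν (suc a) (suc l) + ν (suc a) (suc l) + 1 ≤⟨ twice+1-mono (ν-dropˡ a (suc l)) ⟩
        ν a (suc (suc l)) + ν a (suc (suc l)) + 1 ∎
      by-endpoints (yes _) (no ¬pb) _ ih _ = begin
        count a (suc l) + 𝟙 (P? (a + suc l)) ≡⟨ cong (count a (suc l) +_) (𝟙-no (P? (a + suc l)) ¬pb) ⟩
        count a (suc l) + 0                  ≡⟨ +-identityʳ _ ⟩
        count a (suc l)                      ≤⟨ ih ⟩
        ν a (suc l) + ν a (suc l) + 1        ≤⟨ twice+1-mono (ν-dropʳ a (suc l)) ⟩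
        ν a (suc (suc l)) + ν a (suc (suc l)) + 1 ∎
      by-endpoints (yes pa) (yes pb) _ _ ih = begin
        count a (suc l) + 𝟙 (P? (a + suc l))       ≤⟨ +-mono-≤ (≤-reflexive (split-first l)) (𝟙≤1 (P? (a + suc l))) ⟩
        𝟙 (P? a) + count (suc a) l + 1             ≤⟨ +-monoˡ-≤ 1 (+-mono-≤ (𝟙≤1 (P? a)) ih) ⟩
        1 + (ν (suc a) l + ν (suc a) l + 1) + 1    ≡⟨ arith (ν (suc a) l) ⟩
        suc (ν (suc a) l) + suc (ν (suc a) l) + 1
          ≤⟨ twice+1-mono (ν-arc a l (clique a (a + suc l) (m<m+n a z<s) pa pb)) ⟩
        ν a (suc (suc l)) + ν a (suc (suc l)) + 1  ∎
        where
        arith : ∀ d → 1 + (d + d + 1) + 1 ≡ suc d + suc d + 1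
        arith = solve-∀

  level : ℕ → ℕ → ℕ
  level u w = ν (suc u) (w ∸ suc u)

  level-arc : ∀ {u w a len} → u < w → col u w ≡ red → a ≤ u → suc w ≤ a + len → suc (level u w) ≤ ν a len
  level-arc {u} {w} {a} {len} u<w red-arc a≤u fits = begin
    suc (level u w)                   ≤⟨ ν-arc u (w ∸ suc u) (subst (λ x → col u x ≡ red) (sym w≡) red-arc) ⟩
    ν u (suc (suc (w ∸ suc u)))       ≤⟨ ν-mono a≤u (≤-trans (≤-reflexive (trans (+-suc u _) (cong suc w≡))) fits) ⟩
    ν a len                           ∎
    where
    open ≤-Reasoning
    w≡ : u + suc (w ∸ suc u) ≡ w
    w≡ = trans (+-suc u (w ∸ suc u)) (m+[n∸m]≡n u<w)

  level-nested : ∀ {u w u′ w′} → u < u′ → u′ < w′ → w′ < w → col u′ w′ ≡ red → level u′ w′ < level u w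
  level-nested {u} {w} u<u′ u′<w′ w′<w red-arc =
    level-arc u′<w′ red-arc u<u′ (≤-trans w′<w (≤-reflexive (sym (m+[n∸m]≡n (<-trans u<u′ (<-trans u′<w′ w′<w))))))

  level-room : ∀ {u w} → u < w → suc u + (level u w + level u w) ≤ w
  level-room {u} {w} u<w = ≤-trans (+-monoʳ-≤ (suc u) (ν-half (suc u) (w ∸ suc u))) (≤-reflexive (m+[n∸m]≡n u<w))

-- Only arguments below N are meaningful; larger ones are reduced mod N.
onℕ : ∀ {N} .{{_ : NonZero N}} → Colouring N → ℕ → ℕ → Colour
onℕ {N} c x y = c (x mod N) (y mod N)

toℕ-mod : ∀ {N x} .{{_ : NonZero N}} → x < N → toℕ (x mod N) ≡ x
toℕ-mod {N} {x} x<N = trans (toℕ-fromℕ< _) (m<n⇒m%n≡m x<N)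

module Mirror (n : ℕ) where

  mirror : ℕ → ℕ
  mirror i = n + n ∸ suc i

  mirror-sum : ∀ {i} → i < n + n → suc i + mirror i ≡ n + n
  mirror-sum i<2n = m+[n∸m]≡n i<2n

  mirror-< : ∀ {i} → n ≤ i → i < n + n → mirror i < n
  mirror-< n≤i i<2n = <-+-compensate (s≤s n≤i) (sym (mirror-sum i<2n))

  mirror-anti : ∀ {i j} → i < j → j < n + n → mirror j < mirror i
  mirror-anti i<j j<2n = <-+-compensate (s≤s i<j) (trans (mirror-sum (<-trans i<j j<2n)) (sym (mirror-sum j<2n)))

  matched : ∀ {a b} → a < b → a + b + 1 ≡ n + n → a < n × n ≤ b × mirror b ≡ a
  matched {a} {b} a<b eq = a<n , n≤b , +-cancelˡ-≡ (suc b) _ _ (trans (mirror-sum b<2n) (sym sum≡))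
    where
    sum≡ : suc b + a ≡ n + n
    sum≡ = trans (cong suc (+-comm b a)) (trans (+-comm 1 (a + b)) eq)
    b<2n : b < n + n
    b<2n = m+n≤o⇒n≤o a (≤-reflexive (trans (+-suc a b) (trans (+-comm 1 (a + b)) eq)))
    a<n : a < n
    a<n with a <? n
    ... | yes a<n = a<n
    ... | no a≮n  = ⊥-elim (<-irrefl (sym eq) (begin-strict
          n + n     ≤⟨ +-mono-≤ (≮⇒≥ a≮n) (≮⇒≥ a≮n) ⟩
          a + a     <⟨ +-monoʳ-< a a<b ⟩
          a + b     <⟨ m<m+n (a + b) z<s ⟩
          a + b + 1 ∎))
      where open ≤-Reasoning
    n≤b : n ≤ b
    n≤b with b <? n
    ... | no b≮n  = ≮⇒≥ b≮n
    ... | yes b<n = ⊥-elim (<-irrefl eq (begin-strict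
          a + b + 1 ≡⟨ +-comm (a + b) 1 ⟩
          suc a + b ≤⟨ +-monoˡ-≤ b a<b ⟩
          b + b     <⟨ +-mono-< b<n b<n ⟩
          n + n     ∎))
      where open ≤-Reasoning

module _ {N} (c : Colouring N) where

  BlueTriangle : Fin N → Fin N → Fin N → Set
  BlueTriangle x y z = toℕ x < toℕ y × toℕ y < toℕ z × c x y ≡ blue × c x z ≡ blue × c y z ≡ blue

  blueTriangle? : Dec (∃[ x ] ∃[ y ] ∃[ z ] BlueTriangle x y z)
  blueTriangle? = any? λ x → any? λ y → any? λ z →
    toℕ x <? toℕ y ×-dec toℕ y <? toℕ z ×-dec c x y ≟ᶜ blue ×-dec c x z ≟ᶜ blue ×-dec c y z ≟ᶜ blue

  blueTriangle-copy : ∀ {x y z} → BlueTriangle x y z → MonoCopy blue (Complete 3) c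
  blueTriangle-copy {x} {y} {z} (x<y , y<z , xy , xz , yz) = φ , φ-increasing , φ-blue
    where
    φ : Fin 3 → Fin N
    φ fzero               = x
    φ (fsuc fzero)        = y
    φ (fsuc (fsuc fzero)) = z
    φ-increasing : StrictlyIncreasing φ
    φ-increasing fzero        (fsuc fzero)        _ = x<y
    φ-increasing fzero        (fsuc (fsuc fzero)) _ = <-trans x<y y<z
    φ-increasing (fsuc fzero) (fsuc (fsuc fzero)) _ = y<z
    φ-increasing fzero               fzero               ()
    φ-increasing (fsuc fzero)        fzero               ()
    φ-increasing (fsuc fzero)        (fsuc fzero)        (s≤s ())
    φ-increasing (fsuc (fsuc fzero)) fzero               ()
    φ-increasing (fsuc (fsuc fzero)) (fsuc fzero)        (s≤s ())
    φ-increasing (fsuc (fsuc fzero)) (fsuc (fsuc fzero)) (s≤s (s≤s ()))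
    φ-blue : ∀ i j → toℕ i < toℕ j → Complete 3 i j → c (φ i) (φ j) ≡ blue
    φ-blue fzero        (fsuc fzero)        _ _ = xy
    φ-blue fzero        (fsuc (fsuc fzero)) _ _ = xz
    φ-blue (fsuc fzero) (fsuc (fsuc fzero)) _ _ = yz
    φ-blue fzero               fzero               () _
    φ-blue (fsuc fzero)        fzero               () _
    φ-blue (fsuc fzero)        (fsuc fzero)        (s≤s ()) _
    φ-blue (fsuc (fsuc fzero)) fzero               () _
    φ-blue (fsuc (fsuc fzero)) (fsuc fzero)        (s≤s ()) _
    φ-blue (fsuc (fsuc fzero)) (fsuc (fsuc fzero)) (s≤s (s≤s ())) _

module _ {N} .{{_ : NonZero N}} (c : Colouring N) where

  open NestedMatchings (onℕ c)

  nestedMatching-copy : ∀ {n} → NestedRedMatching n 0 N → MonoCopy red (NestedMatching n) c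
  nestedMatching-copy {n} M = φ , φ-increasing , φ-red
    where
    open NestedRedMatching M
    open Mirror n

    vertex : ℕ → ℕ
    vertex i with i <? n
    ... | yes _ = left i
    ... | no  _ = right (mirror i)

    vertex-left : ∀ {i} → i < n → vertex i ≡ left i
    vertex-left {i} i<n with i <? n
    ... | yes _   = refl
    ... | no  i≮n = ⊥-elim (i≮n i<n)

    vertex-right : ∀ {i} → n ≤ i → vertex i ≡ right (mirror i)
    vertex-right {i} n≤i with i <? n
    ... | yes i<n = ⊥-elim (<⇒≱ i<n n≤i)
    ... | no  _   = refl

    vertex-< : ∀ {i} → i < n + n → vertex i < N
    vertex-< {i} i<2n with i <? n
    ... | yes i<n = <-trans (left<right i i i<n i<n) (proj₂ (inside i i<n))
    ... | no  i≮n = proj₂ (inside (mirror i) (mirror-< (≮⇒≥ i≮n) i<2n))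

    vertex-increasing : ∀ {i j} → i < j → j < n + n → vertex i < vertex j
    vertex-increasing {i} {j} i<j j<2n with i <? n | j <? n
    ... | yes i<n | yes j<n = proj₁ (nested i j i<j j<n)
    ... | yes i<n | no  j≮n = left<right i (mirror j) i<n (mirror-< (≮⇒≥ j≮n) j<2n)
    ... | no  i≮n | yes j<n = ⊥-elim (i≮n (<-trans i<j j<n))
    ... | no  i≮n | no  j≮n =
      proj₂ (nested (mirror j) (mirror i) (mirror-anti i<j j<2n) (mirror-< (≮⇒≥ i≮n) (<-trans i<j j<2n)))

    <2n : (i : Fin (2 * n)) → toℕ i < n + n
    <2n i = subst (toℕ i <_) (cong (n +_) (+-identityʳ n)) (toℕ<n i)

    φ : Fin (2 * n) → Fin N
    φ i = vertex (toℕ i) mod N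

    toℕ-φ : ∀ i → toℕ (φ i) ≡ vertex (toℕ i)
    toℕ-φ i = toℕ-mod (vertex-< (<2n i))

    φ-increasing : StrictlyIncreasing φ
    φ-increasing i j i<j rewrite toℕ-φ i | toℕ-φ j = vertex-increasing i<j (<2n j)

    φ-red : ∀ i j → toℕ i < toℕ j → NestedMatching n i j → c (φ i) (φ j) ≡ red
    φ-red i j i<j edge with matched i<j (trans edge (cong (n +_) (+-identityʳ n)))
    ... | a<n , n≤b , mirror≡ rewrite vertex-left a<n | vertex-right n≤b | mirror≡ = red-arcs (toℕ i) a<n

  no-blueTriangle-onℕ : ¬ (∃[ x ] ∃[ y ] ∃[ z ] BlueTriangle c x y z) →
    ∀ x y z → x < y → y < z → z < N → onℕ c x y ≡ blue → onℕ c x z ≡ blue → onℕ c y z ≡ blue → ⊥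
  no-blueTriangle-onℕ none x y z x<y y<z z<N xy xz yz =
    none (x mod N , y mod N , z mod N , ordered x<y (<-trans x<y (<-trans y<z z<N)) (<-trans y<z z<N) ,
          ordered y<z (<-trans y<z z<N) z<N , xy , xz , yz)
    where
    ordered : ∀ {a b} → a < b → a < N → b < N → toℕ (a mod N) < toℕ (b mod N)
    ordered a<b a<N b<N = subst₂ _<_ (sym (toℕ-mod a<N)) (sym (toℕ-mod b<N)) a<b

module DegreeCount (col : ℕ → ℕ → Colour) (N : ℕ)
  (no-blue-triangle : ∀ x y z → x < y → y < z → z < N →
                      col x y ≡ blue → col x z ≡ blue → col y z ≡ blue → ⊥) where

  open NestedMatchings col

  RedArc : ℕ → ℕ → Set
  RedArc u w = u < w × col u w ≡ red

  redArc? : ∀ u w → Dec (RedArc u w)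
  redArc? u w = u <? w ×-dec col u w ≟ᶜ red

  BlueNeighbour : ℕ → ℕ → Set
  BlueNeighbour v x = x < N × ((v < x × col v x ≡ blue) ⊎ (x < v × col x v ≡ blue))

  blueNeighbour? : ∀ v x → Dec (BlueNeighbour v x)
  blueNeighbour? v x = x <? N ×-dec (v <? x ×-dec col v x ≟ᶜ blue ⊎-dec x <? v ×-dec col x v ≟ᶜ blue)

  blueNeighbours-clique : ∀ {v} → v < N → ∀ x y → x < y → BlueNeighbour v x → BlueNeighbour v y → col x y ≡ red
  blueNeighbours-clique {v} v<N x y x<y (x<N , vx) (y<N , vy) with col x y in xy
  ... | red  = refl
  ... | blue with vx | vy
  ...   | inj₁ (v<x , vx-blue) | inj₁ (_ , vy-blue)   = ⊥-elim (no-blue-triangle v x y v<x x<y y<N vx-blue vy-blue xy)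
  ...   | inj₂ (x<v , xv-blue) | inj₁ (v<y , vy-blue) = ⊥-elim (no-blue-triangle x v y x<v v<y y<N xv-blue xy vy-blue)
  ...   | inj₂ (_ , xv-blue)   | inj₂ (y<v , yv-blue) = ⊥-elim (no-blue-triangle x y v x<y y<v v<N xy xv-blue yv-blue)
  ...   | inj₁ (v<x , _)       | inj₂ (y<v , _)       = ⊥-elim (<-asym (<-trans v<x x<y) y<v)

  blueDegree-≤ : ∀ {v} → v < N → ∑[ x < N ] 𝟙 (blueNeighbour? v x) ≤ ν 0 N + ν 0 N + 1
  blueDegree-≤ {v} v<N = clique-≤ (blueNeighbour? v) (blueNeighbours-clique v<N) 0 N

  classify : ∀ u w → w < N → RedArc u w ⊎ RedArc w u ⊎ BlueNeighbour u w ⊎ u ≡ w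
  classify u w w<N with <-cmp u w | col u w | col w u
  ... | tri< u<w _ _ | red  | _    = inj₁ (u<w , refl)
  ... | tri< u<w _ _ | blue | _    = inj₂ (inj₂ (inj₁ (w<N , inj₁ (u<w , refl))))
  ... | tri≈ _ u≡w _ | _    | _    = inj₂ (inj₂ (inj₂ u≡w))
  ... | tri> _ _ w<u | _    | red  = inj₂ (inj₁ (w<u , refl))
  ... | tri> _ _ w<u | _    | blue = inj₂ (inj₂ (inj₁ (w<N , inj₂ (w<u , refl))))

  outDegree inDegree blueDegree loops : ℕ → ℕ
  outDegree  u = ∑[ w < N ] 𝟙 (redArc? u w)
  inDegree   u = ∑[ w < N ] 𝟙 (redArc? w u)
  blueDegree u = ∑[ w < N ] 𝟙 (blueNeighbour? u w)
  loops      u = ∑[ w < N ] 𝟙 (u ≟ w)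

  degree : ∀ u → N ≤ outDegree u + (inDegree u + (blueDegree u + loops u))
  degree u = begin
    N                    ≡⟨ trans (sym (*-identityʳ N)) (sym (∑-const N 1)) ⟩
    ∑[ w < N ] 1         ≤⟨ ∑-mono-≤ N (λ w w<N → ≤-reflexive (sym (𝟙-yes (kinds? w) (classify u w w<N)))) ⟩
    ∑[ w < N ] 𝟙 (kinds? w)
      ≤⟨ ∑-mono-≤ N (λ w _ → ≤-trans (𝟙-⊎-≤ (redArc? u w) _) (+-monoʳ-≤ _ (≤-trans (𝟙-⊎-≤ (redArc? w u) _)
                             (+-monoʳ-≤ _ (𝟙-⊎-≤ (blueNeighbour? u w) (u ≟ w)))))) ⟩
    ∑[ w < N ] (𝟙 (redArc? u w) + (𝟙 (redArc? w u) + (𝟙 (blueNeighbour? u w) + 𝟙 (u ≟ w))))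
      ≡⟨ ∑-distrib-+ N _ _ ⟩
    outDegree u + ∑[ w < N ] (𝟙 (redArc? w u) + (𝟙 (blueNeighbour? u w) + 𝟙 (u ≟ w)))
      ≡⟨ cong (outDegree u +_) (trans (∑-distrib-+ N _ _) (cong (inDegree u +_) (∑-distrib-+ N _ _))) ⟩
    outDegree u + (inDegree u + (blueDegree u + loops u)) ∎
    where
    open ≤-Reasoning
    kinds? : ∀ w → Dec (RedArc u w ⊎ RedArc w u ⊎ BlueNeighbour u w ⊎ u ≡ w)
    kinds? w = redArc? u w ⊎-dec redArc? w u ⊎-dec blueNeighbour? u w ⊎-dec u ≟ w

  redArcCount : ℕ
  redArcCount = ∑[ u < N ] outDegree u

  degree-sum : ∀ k → ν 0 N ≤ k → N * N ≤ redArcCount + (redArcCount + N * (k + k + 2))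
  degree-sum k ν≤k = begin
    N * N                                                          ≡⟨ ∑-const N N ⟨
    ∑[ u < N ] N                                                   ≤⟨ ∑-mono-≤ N vertexBound ⟩
    ∑[ u < N ] (outDegree u + (inDegree u + (k + k + 2)))          ≡⟨ ∑-distrib-+ N _ _ ⟩
    redArcCount + ∑[ u < N ] (inDegree u + (k + k + 2))
      ≡⟨ cong (redArcCount +_) (trans (∑-distrib-+ N _ _) (cong₂ _+_ (∑-comm N N (λ u w → 𝟙 (redArc? w u)))
                                                                     (∑-const N (k + k + 2)))) ⟩
    redArcCount + (redArcCount + N * (k + k + 2))                  ∎
    where
    open ≤-Reasoning
    loops≤1 : ∀ u → loops u ≤ 1
    loops≤1 u = ∑-𝟙-≤1 (u ≟_) N λ _ _ _ _ u≡i u≡j → trans (sym u≡i) u≡j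
    vertexBound : ∀ u → u < N → N ≤ outDegree u + (inDegree u + (k + k + 2))
    vertexBound u u<N = ≤-trans (degree u) (+-monoʳ-≤ (outDegree u) (+-monoʳ-≤ (inDegree u)
      (≤-trans (+-mono-≤ (blueDegree-≤ u<N) (loops≤1 u))
               (≤-trans (≤-reflexive (+-assoc (ν 0 N + ν 0 N) 1 1)) (+-monoˡ-≤ 2 (+-mono-≤ ν≤k ν≤k))))))

  -- Red arcs of level j have endpoint sums in [lo j, hi j), and distinct ones have distinct sums.
  lo hi : ℕ → ℕ
  lo j = suc (j + j)
  hi j = N + N ∸ suc (suc (j + j))

  levelArcs-≤ : ∀ j → ∑[ u < N ] ∑[ w < N ] 𝟙 (redArc? u w ×-dec level u w ≟ j) ≤ hi j ∸ lo j
  levelArcs-≤ j = ∑∑-𝟙-distinct-sums (λ u w → redArc? u w ×-dec level u w ≟ j) N (lo j) (hi j) inRange unique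
    where
    inRange : ∀ u w → u < N → w < N → RedArc u w × level u w ≡ j → lo j ≤ u + w × u + w < hi j
    inRange u w _ w<N ((u<w , _) , level≡j) =
      ≤-trans (s≤s (m≤n+m (j + j) u)) (≤-trans room (m≤n+m w u)) ,
      m+n≤o⇒m≤o∸n (suc (u + w)) (≤-trans (≤-reflexive (arith u w j)) (+-mono-≤ (≤-trans (s≤s room) w<N) w<N))
      where
      room : suc u + (j + j) ≤ w
      room = subst (λ l → suc u + (l + l) ≤ w) level≡j (level-room u<w)
      arith : ∀ u w j → suc (u + w) + suc (suc (j + j)) ≡ suc (suc u + (j + j)) + suc w
      arith = solve-∀
    unique : ∀ u w u′ w′ → RedArc u w × level u w ≡ j → RedArc u′ w′ × level u′ w′ ≡ j →
             u + w ≡ u′ + w′ → u ≡ u′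
    unique u w u′ w′ ((u<w , red-uw) , l≡j) ((u′<w′ , red-u′w′) , l′≡j) sum with <-cmp u u′
    ... | tri≈ _ u≡u′ _ = u≡u′
    ... | tri< u<u′ _ _ = ⊥-elim (<-irrefl (trans l′≡j (sym l≡j))
                            (level-nested u<u′ u′<w′ (<-+-compensate u<u′ sum) red-u′w′))
    ... | tri> _ _ u′<u = ⊥-elim (<-irrefl (trans l≡j (sym l′≡j))
                            (level-nested u′<u u<w (<-+-compensate u′<u (sym sum)) red-uw))

  redArcs-≤ : ∀ k → ν 0 N ≤ k → redArcCount ≤ ∑[ j < k ] (hi j ∸ lo j)
  redArcs-≤ k ν≤k = begin
    redArcCount
      ≤⟨ ∑∑-𝟙-fibres redArc? N N k level (λ u w _ w<N (u<w , red-uw) → <-≤-trans (level-arc u<w red-uw z≤n w<N) ν≤k) ⟩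
    ∑[ j < k ] ∑[ u < N ] ∑[ w < N ] 𝟙 (redArc? u w ×-dec level u w ≟ j) ≤⟨ ∑-mono-≤ k (λ j _ → levelArcs-≤ j) ⟩
    ∑[ j < k ] (hi j ∸ lo j)                                                ∎
    where open ≤-Reasoning

  capacity : ∀ k → k + k ≤ N → ∑[ j < k ] (hi j ∸ lo j) + k * (k + k + 1) ≡ k * (N + N)
  capacity k 2k≤N = begin
    ∑[ j < k ] (hi j ∸ lo j) + k * (k + k + 1)                      ≡⟨ cong (∑[ j < k ] (hi j ∸ lo j) +_) (∑-lo+gap k) ⟨
    ∑[ j < k ] (hi j ∸ lo j) + ∑[ j < k ] (lo j + suc (suc (j + j))) ≡⟨ ∑-distrib-+ k _ _ ⟨
    ∑[ j < k ] (hi j ∸ lo j + (lo j + suc (suc (j + j))))          ≡⟨ ∑-cong k fill ⟩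
    ∑[ j < k ] (N + N)                                              ≡⟨ ∑-const k (N + N) ⟩
    k * (N + N)                                                     ∎
    where
    open ≡-Reasoning
    ∑-lo+gap : ∀ k → ∑[ j < k ] (lo j + suc (suc (j + j))) ≡ k * (k + k + 1)
    ∑-lo+gap zero    = refl
    ∑-lo+gap (suc k) = trans (cong (_+ (lo k + suc (suc (k + k)))) (∑-lo+gap k)) (arith k)
      where
      arith : ∀ k → k * (k + k + 1) + (suc (k + k) + suc (suc (k + k))) ≡ suc k * (suc k + suc k + 1)
      arith = solve-∀
    fill : ∀ j → j < k → hi j ∸ lo j + (lo j + suc (suc (j + j))) ≡ N + N
    fill j j<k = begin
      hi j ∸ lo j + (lo j + gap)  ≡⟨ +-assoc (hi j ∸ lo j) (lo j) gap ⟨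
      hi j ∸ lo j + lo j + gap    ≡⟨ cong (_+ gap) (m∸n+n≡m (m+n≤o⇒m≤o∸n (lo j) fits)) ⟩
      N + N ∸ gap + gap           ≡⟨ m∸n+n≡m (m+n≤o⇒n≤o (lo j) fits) ⟩
      N + N                       ∎
      where
      gap = suc (suc (j + j))
      fits : lo j + gap ≤ N + N
      fits = ≤-trans (+-mono-≤ (≤-trans (n≤1+n (lo j)) gap≤) gap≤) (+-mono-≤ 2k≤N 2k≤N)
        where
        gap≤ : gap ≤ k + k
        gap≤ = ≤-trans (≤-reflexive (cong suc (sym (+-suc j j)))) (+-mono-≤ j<k j<k)

  degree-count : ∀ k → ν 0 N ≤ k → k + k ≤ N →
    N * N + (k * (k + k + 1) + k * (k + k + 1)) ≤ k * (N + N) + (k * (N + N) + N * (k + k + 2))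
  degree-count k ν≤k 2k≤N = begin
    N * N + (X + X)                       ≤⟨ +-monoˡ-≤ (X + X) (degree-sum k ν≤k) ⟩
    S + (S + N * (k + k + 2)) + (X + X)   ≡⟨ regroup S X (N * (k + k + 2)) ⟩
    S + X + (S + X + N * (k + k + 2))     ≤⟨ +-mono-≤ S+X≤ (+-monoˡ-≤ (N * (k + k + 2)) S+X≤) ⟩
    k * (N + N) + (k * (N + N) + N * (k + k + 2)) ∎
    where
    open ≤-Reasoning
    S = redArcCount
    X = k * (k + k + 1)
    S+X≤ : S + X ≤ k * (N + N)
    S+X≤ = ≤-trans (+-monoˡ-≤ X (redArcs-≤ k ν≤k)) (≤-reflexive (capacity k 2k≤N))
    regroup : ∀ s x c → s + (s + c) + (x + x) ≡ s + x + (s + x + c)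
    regroup = solve-∀

integerSqrt : ∀ K → ∃[ m ] m * m ≤ K × K < suc m * suc m
integerSqrt zero = 0 , z≤n , s≤s z≤n
integerSqrt (suc K) with integerSqrt K
... | m , m²≤K , K<[1+m]² with suc m * suc m ≤? suc K
...   | yes [1+m]²≤1+K = suc m , [1+m]²≤1+K ,
                       ≤-trans (s≤s K<[1+m]²) (≤-trans (m≤m+n _ (m + m + 2)) (≤-reflexive (arith m)))
  where
  arith : ∀ m → suc (suc m * suc m) + (m + m + 2) ≡ suc (suc m) * suc (suc m)
  arith = solve-∀
...   | no  [1+m]²≰1+K = m , ≤-trans m²≤K (n≤1+n K) , ≰⇒> [1+m]²≰1+K

-- Here n = 1 + k and N = 3n + 1 + m with (m + 1)² > 5n²: N lies beyond the larger root
-- 3n - 2 + √(5n² - 6n + 2) of the quadratic in N behind the inequality.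
beyond-root : ∀ k m → 5 * (suc k * suc k) < suc m * suc m → let N = suc (3 * suc k + m) in
  ¬ (N * N + (k * (k + k + 1) + k * (k + k + 1)) ≤ k * (N + N) + (k * (N + N) + N * (k + k + 2)))
beyond-root k m 5n²<[1+m]² L≤R = <-irrefl refl (begin-strict
  L + 5n²                          ≤⟨ +-monoˡ-≤ 5n² L≤R ⟩
  R + 5n²                          <⟨ +-monoʳ-< R 5n²<[1+m]² ⟩
  R + suc m * suc m                ≤⟨ +-monoʳ-≤ R (m≤m+n _ _) ⟩
  R + (suc m * suc m + (4 * m + 6 * k + 12)) ≡⟨ identity k m ⟨
  L + 5n²                          ∎)
  where
  open ≤-Reasoning
  N = suc (3 * suc k + m)
  L = N * N + (k * (k + k + 1) + k * (k + k + 1))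
  R = k * (N + N) + (k * (N + N) + N * (k + k + 2))
  5n² = 5 * (suc k * suc k)
  identity : ∀ k m → let N = suc (3 * suc k + m) in
    N * N + (k * (k + k + 1) + k * (k + k + 1)) + 5 * (suc k * suc k) ≡
    k * (N + N) + (k * (N + N) + N * (k + k + 2)) + (suc m * suc m + (4 * m + 6 * k + 12))
  identity = solve-∀

theorem6 : (n : ℕ) → 1 ≤ n → ∃[ N ] (LeThreePlusSqrt5TimesPlusOne N n × Arrows N (NestedMatching n) (Complete 3))
theorem6 (suc k) _ with integerSqrt (5 * (suc k * suc k))
... | m , m²≤5n² , 5n²<[1+m]² = N , within-bound , arrows
  where
  N = suc (3 * suc k + m)

  within-bound : LeThreePlusSqrt5TimesPlusOne N (suc k)
  within-bound = subst (λ d → d * d ≤ 5 * (suc k * suc k)) (sym excess) m²≤5n²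
    where
    excess : N ∸ (3 * suc k + 1) ≡ m
    excess = trans (cong (N ∸_) (+-comm (3 * suc k) 1)) (m+n∸m≡n (3 * suc k) m)

  2k≤N : k + k ≤ N
  2k≤N = ≤-trans (m≤m+n (k + k) (k + 4 + m)) (≤-reflexive (arith k m))
    where
    arith : ∀ k m → k + k + (k + 4 + m) ≡ suc (3 * suc k + m)
    arith = solve-∀

  arrows : Arrows N (NestedMatching (suc k)) (Complete 3)
  arrows c with suc k ≤? NestedMatchings.ν (onℕ c) 0 N
  ... | yes n≤ν = inj₁ (nestedMatching-copy c (NestedMatchings.realise (onℕ c) N 0 n≤ν))
  ... | no  n≰ν with blueTriangle? c
  ...   | yes (_ , _ , _ , triangle) = inj₂ (blueTriangle-copy c triangle)
  ...   | no  none = ⊥-elim (beyond-root k m 5n²<[1+m]²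
                       (DegreeCount.degree-count (onℕ c) N (no-blueTriangle-onℕ c none) k (≤-pred (≰⇒> n≰ν)) 2k≤N))
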